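{- For every integer $n\geq 0$, $2I^1_n-1=I^2_n$.
   Context: Let $X_n=\{1,\dots,n\}$. A preferential arrangement of a finite set is an ordered set partition: a linearly ordered sequence of pairwise disjoint nonempty subsets (blocks) whose union is the set. A restricted barred preferential arrangement of $X_n$ with $m$ bars is a sequence of $m+1$ sections $S_1,\dots,S_{m+1}$, where the $S_i$ are pairwise disjoint, possibly empty, subsets with union $X_n$, such that each of the first $m$ sections $S_1,\dots,S_m$ consists of at most one block (it is either empty or a single block containing all its elements), while the last section $S_{m+1}$ (the free section) carries an arbitrary preferential arrangement of its elements (possibly empty, possibly with several blocks). $I^m_n$ denotes the number of restricted barred preferential arrangements of $X_n$ with $m$ bars. -}

module Defs where

open import Data.Nat using (ℕ; zero; suc; _<ᵇ_)
open import Data.Bool using (Bool; true; false; _∨_; not)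
open import Data.Fin using (Fin; toℕ)
open import Data.Fin.Properties using (_≟_)
open import Data.Sum using (_⊎_; inj₁; inj₂)
open import Data.List using (List; []; _∷_; map; _++_; concatMap; length; filterᵇ; allFin)
open import Data.Bool.ListAction using (any; all)
open import Data.Vec using (Vec; []; _∷_; toList)
open import Relation.Nullary.Decidable using (⌊_⌋)

-- An element of X_n = Fin n receives a label:
--   inj₁ s  (s : Fin m)  : it lies in the restricted section S_(s+1) (s = 0..m-1),
--                         which is a single block (or empty);
--   inj₂ b  (b : Fin n)  : it lies in the free section S_(m+1), in its b-th block
--                         (blocks ordered by b).
-- The free-section labels must be exactly {0,..,k-1} for some k, so that
-- the labelling encodes an ordered set partition of the free section
-- (at most n blocks, hence Fin n suffices).
Label : ℕ → ℕ → Set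
Label m n = Fin m ⊎ Fin n

labels : (m n : ℕ) → List (Label m n)
labels m n = map inj₁ (allFin m) ++ map inj₂ (allFin n)

allVecs : {A : Set} → List A → (k : ℕ) → List (Vec A k)
allVecs xs zero = [] ∷ []
allVecs xs (suc k) = concatMap (λ x → map (x ∷_) (allVecs xs k)) xs

isBlock : {m n : ℕ} → Fin n → Label m n → Bool
isBlock b (inj₁ _) = false
isBlock b (inj₂ c) = ⌊ b ≟ c ⌋

used : {m n k : ℕ} → Vec (Label m n) k → Fin n → Bool
used v b = any (isBlock b) (toList v)

valid : {m n k : ℕ} → Vec (Label m n) k → Bool
valid {m} {n} v =
  all (λ j → not (used v j) ∨ all (λ i → not (toℕ i <ᵇ toℕ j) ∨ used v i) (allFin n)) (allFin n)

I : ℕ → ℕ → ℕ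
I m n = length (filterᵇ valid (allVecs (labels m n) n))

-- Split the two-bar arrangements according to whether the second section S₂ is empty.  If it is,
-- deleting the second bar is a bijection onto the one-bar arrangements.  If it is not, deleting
-- the second bar makes S₂ the first block of the free section: a bijection onto the one-bar
-- arrangements with nonempty free section, which are all of them except the one putting
-- everything into S₁.  Hence I²ₙ = I¹ₙ + (I¹ₙ − 1).

module Submission where

open import Defs
open import Data.Nat using (ℕ)
open import Data.Integer using (ℤ; +_; _*_; _-_)
open import Relation.Binary.PropositionalEquality using (_≡_)

open import Data.Bool using (Bool; true; false; T; _∧_; _∨_; not)
open import Data.Bool.Properties using (T-∧)
open import Data.Bool.ListAction using (all)
open import Data.Fin using (Fin; zero; suc; toℕ; fromℕ; inject₁; _<_)
open import Data.Fin.Properties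
  using (_≟_; any?; injective⇒≤; ≤fromℕ; ≤∧≢⇒<; fromℕ≢inject₁; toℕ-inject₁)
open import Data.Fin.Relation.Unary.Top using (view; ‵fromℕ; ‵inject₁; view-inject₁)
open import Data.List using (List; []; _∷_; length; filterᵇ; allFin; cartesianProductWith)
import Data.List as List
open import Data.List.Properties using (length-map; map-∘; map-id-local)
open import Data.List.Membership.Propositional using () renaming (_∈_ to _∈ₗ_)
open import Data.List.Membership.Propositional.Properties
  using (∈-filter⁺; ∈-filter⁻; ∈-allFin; ∈-++⁺ˡ; ∈-++⁺ʳ; ∈-cartesianProductWith⁺)
  renaming (∈-map⁺ to ∈ₗ-map⁺; ∈-map⁻ to ∈ₗ-map⁻)
open import Data.List.Membership.Propositional.Properties.WithK using (unique∧set⇒bag)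
open import Data.List.Relation.Unary.All as All using (All; []; _∷_)
open import Data.List.Relation.Unary.All.Properties using (all⁺; all⁻; all-filter)
open import Data.List.Relation.Unary.Any using (here)
open import Data.List.Relation.Unary.Any.Properties using (any⁺; any⁻)
open import Data.List.Relation.Unary.AllPairs using ([]; _∷_)
open import Data.List.Relation.Unary.Unique.Propositional using (Unique)
import Data.List.Relation.Unary.Unique.Propositional.Properties as Unique
open import Data.List.Relation.Binary.BagAndSetEquality using (_∼[_]_; set; ∼bag⇒↭)
open import Data.List.Relation.Binary.Permutation.Propositional.Properties using (↭-length)
open import Data.Nat using (_+_; _≤_; suc; z<s; s<s; _<ᵇ_) renaming (_<_ to _<ℕ_)
import Data.Nat.Properties as ℕ
open import Data.Product using (∃; _×_; _,_; proj₁; proj₂)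
open import Data.Sum using (inj₁; inj₂)
import Data.Sum as Sum
open import Data.Sum.Properties using (inj₁-injective; inj₂-injective; ≡-dec)
open import Data.Unit using (tt)
open import Data.Vec using (Vec; []; _∷_; map; replicate; lookup; toList)
open import Data.Vec.Membership.Propositional using (_∈_; _∉_)
open import Data.Vec.Membership.Propositional.Properties using (∈-map⁺)
open import Data.Vec.Properties using (∷-injective)
open import Data.Vec.Relation.Unary.Any as Any using (here; there; index)
open import Data.Vec.Relation.Unary.Any.Properties using (lookup-index; toList⁺; toList⁻)
import Data.Vec.Relation.Unary.Any.Properties as Anyₚ
open import Function using (_∘_)
open import Function.Bundles using (_⇔_; mk⇔; Equivalence)
open import Function.Definitions using (Injective)
open import Relation.Nullary using (Dec; yes; no; ¬_; contradiction)
open import Relation.Nullary.Decidable using (⌊_⌋; T?; toWitness; fromWitness; toWitnessFalse; fromWitnessFalse)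
open import Relation.Binary.PropositionalEquality
  using (_≢_; refl; sym; trans; cong; cong₂; subst; subst₂; module ≡-Reasoning)

open Equivalence using (to; from)
open ≡-Reasoning

private
  variable
    A B : Set
    m n k k′ : ℕ

count : (A → Bool) → List A → ℕ
count p xs = length (filterᵇ p xs)

count-split : (p q : A → Bool) (xs : List A) →
              count p xs ≡ count (λ x → p x ∧ not (q x)) xs + count (λ x → p x ∧ q x) xs
count-split p q [] = refl
count-split p q (x ∷ xs) with p x | q x
... | false | _     = count-split p q xs
... | true  | false = cong suc (count-split p q xs)
... | true  | true  = trans (cong suc (count-split p q xs)) (sym (ℕ.+-suc _ _))

Enumerates : List A → Set
Enumerates xs = Unique xs × (∀ x → x ∈ₗ xs)

unique-map⁺-local : {f : A → B} (g : B → A) {xs : List A} →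
                    All (λ x → g (f x) ≡ x) xs → Unique xs → Unique (List.map f xs)
unique-map⁺-local {f = f} g {xs} gf xs! = Unique.map⁻ (subst Unique xs≡gfxs xs!)
  where
  xs≡gfxs : xs ≡ List.map g (List.map f xs)
  xs≡gfxs = trans (sym (map-id-local gf)) (map-∘ xs)

count-inverse : {p : A → Bool} {q : B → Bool} {xs : List A} {ys : List B}
                (f : A → B) (g : B → A) → Enumerates xs → Enumerates ys →
                (∀ {x} → T (p x) → T (q (f x)) × g (f x) ≡ x) →
                (∀ {y} → T (q y) → T (p (g y)) × f (g y) ≡ y) →
                count p xs ≡ count q ys
count-inverse {p = p} {q} {xs} {ys} f g (xs! , ∈xs) (ys! , ∈ys) forth back = begin
  count p xs                          ≡⟨ length-map f (filterᵇ p xs) ⟨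
  length (List.map f (filterᵇ p xs))  ≡⟨ ↭-length (∼bag⇒↭ (unique∧set⇒bag fxs! (Unique.filter⁺ _ ys!) same)) ⟩
  count q ys                          ∎
  where
  fxs! : Unique (List.map f (filterᵇ p xs))
  fxs! = unique-map⁺-local g (All.map (proj₂ ∘ forth) (all-filter (T? ∘ p) xs)) (Unique.filter⁺ _ xs!)
  same : List.map f (filterᵇ p xs) ∼[ set ] filterᵇ q ys
  same {z} = mk⇔ image⊆ ⊆image
    where
    image⊆ : z ∈ₗ List.map f (filterᵇ p xs) → z ∈ₗ filterᵇ q ys
    image⊆ z∈ with x , x∈ , refl ← ∈ₗ-map⁻ f z∈ =
      ∈-filter⁺ (T? ∘ q) (∈ys (f x)) (proj₁ (forth (proj₂ (∈-filter⁻ (T? ∘ p) {xs = xs} x∈))))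
    ⊆image : z ∈ₗ filterᵇ q ys → z ∈ₗ List.map f (filterᵇ p xs)
    ⊆image z∈ with pgz , fgz ← back (proj₂ (∈-filter⁻ (T? ∘ q) {xs = ys} z∈)) =
      subst (_∈ₗ List.map f (filterᵇ p xs)) fgz (∈ₗ-map⁺ f (∈-filter⁺ (T? ∘ p) (∈xs (g z)) pgz))

count-≡1 : {p : A → Bool} {xs : List A} (a : A) → Enumerates xs →
           (∀ {x} → T (p x) ⇔ x ≡ a) → count p xs ≡ 1
count-≡1 a xs-enum p⇔≡a =
  count-inverse {q = λ _ → true} {ys = tt ∷ []} (λ _ → tt) (λ _ → a) xs-enum
    (([] ∷ []) , λ _ → here refl)
    (λ px → _ , sym (to p⇔≡a px))
    (λ _ → from p⇔≡a refl , refl)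

allVecs-cartesianProduct : (xs : List A) (k : ℕ) →
                           allVecs xs (suc k) ≡ cartesianProductWith _∷_ xs (allVecs xs k)
allVecs-cartesianProduct xs k = go xs
  where
  go : ∀ ys → List.concatMap (λ y → List.map (y ∷_) (allVecs xs k)) ys
            ≡ cartesianProductWith _∷_ ys (allVecs xs k)
  go []       = refl
  go (y ∷ ys) = cong (List.map (y ∷_) (allVecs xs k) List.++_) (go ys)

allVecs-enumerates : {xs : List A} → Enumerates xs → (k : ℕ) → Enumerates (allVecs xs k)
allVecs-enumerates xs-enum 0 = ([] ∷ []) , λ { [] → here refl }
allVecs-enumerates {xs = xs} (xs! , ∈xs) (suc k) rewrite allVecs-cartesianProduct xs k =
  Unique.cartesianProductWith⁺ _∷_ ∷-injective xs! (proj₁ vs-enum) ,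
  λ { (x ∷ v) → ∈-cartesianProductWith⁺ _∷_ (∈xs x) (proj₂ vs-enum v) }
  where
  vs-enum : Enumerates (allVecs xs k)
  vs-enum = allVecs-enumerates (xs! , ∈xs) k

map∘map-cancel : {f : A → B} {g : B → A} (v : Vec A k) →
                 (∀ {x} → x ∈ v → g (f x) ≡ x) → map g (map f v) ≡ v
map∘map-cancel []      _  = refl
map∘map-cancel (x ∷ v) gf = cong₂ _∷_ (gf (here refl)) (map∘map-cancel v (gf ∘ there))

∈-map-injective : {f : A → B} {v : Vec A k} → Injective _≡_ _≡_ f → ∀ x → f x ∈ map f v ⇔ x ∈ v
∈-map-injective {f = f} f-injective x = mk⇔ (Any.map f-injective ∘ Anyₚ.map⁻) (∈-map⁺ f)

∉-map : {f : A → B} {v : Vec A k} {y : B} → (∀ x → y ≢ f x) → y ∉ map f v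
∉-map y≢f y∈ = y≢f _ (lookup-index (Anyₚ.map⁻ y∈))

injective-∈⇒≤ : {v : Vec A n} (f : Fin m → A) → Injective _≡_ _≡_ f → (∀ i → f i ∈ v) → m ≤ n
injective-∈⇒≤ {v = v} f f-injective f∈v = injective⇒≤ index-injective
  where
  index-injective : ∀ {i j} → index (f∈v i) ≡ index (f∈v j) → i ≡ j
  index-injective {i} {j} eq = f-injective (begin
    f i                       ≡⟨ lookup-index (f∈v i) ⟩
    lookup v (index (f∈v i))  ≡⟨ cong (lookup v) eq ⟩
    lookup v (index (f∈v j))  ≡⟨ lookup-index (f∈v j) ⟨
    f j                       ∎)

T-not-∨ : ∀ {a b} → T (not a ∨ b) ⇔ (T a → T b)
T-not-∨ {true}  = mk⇔ (λ t _ → t) (λ f → f tt)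
T-not-∨ {false} = mk⇔ (λ _ ()) (λ _ → tt)

T-all-allFin : (p : Fin n → Bool) → T (all p (allFin n)) ⇔ (∀ i → T (p i))
T-all-allFin {n} p = mk⇔ (λ t i → All.lookup (all⁺ p (allFin n) t) (∈-allFin i))
                         (λ h → all⁻ p {xs = allFin n} (All.tabulate (λ {i} _ → h i)))

labels-enumerates : (m n : ℕ) → Enumerates (labels m n)
labels-enumerates m n = labels! , ∈labels
  where
  labels! : Unique (labels m n)
  labels! = Unique.++⁺ (Unique.map⁺ inj₁-injective (Unique.allFin⁺ m))
                       (Unique.map⁺ inj₂-injective (Unique.allFin⁺ n)) disjoint
    where
    disjoint : ∀ {l} → ¬ (l ∈ₗ List.map inj₁ (allFin m) × l ∈ₗ List.map inj₂ (allFin n))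
    disjoint (l∈₁ , l∈₂) with ∈ₗ-map⁻ inj₁ l∈₁ | ∈ₗ-map⁻ inj₂ l∈₂
    ... | _ , _ , refl | _ , _ , ()
  ∈labels : ∀ l → l ∈ₗ labels m n
  ∈labels (inj₁ s) = ∈-++⁺ˡ (∈ₗ-map⁺ inj₁ (∈-allFin s))
  ∈labels (inj₂ b) = ∈-++⁺ʳ (List.map inj₁ (allFin m)) (∈ₗ-map⁺ inj₂ (∈-allFin b))

arrangements : (m n : ℕ) → List (Vec (Label m n) n)
arrangements m n = allVecs (labels m n) n

arrangements-enumerates : (m n : ℕ) → Enumerates (arrangements m n)
arrangements-enumerates m n = allVecs-enumerates (labels-enumerates m n) n

Valid : Vec (Label m n) k → Set
Valid {n = n} v = ∀ {i j : Fin n} → i < j → inj₂ j ∈ v → inj₂ i ∈ v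

used⇔∈ : {v : Vec (Label m n) k} {b : Fin n} → T (used v b) ⇔ inj₂ b ∈ v
used⇔∈ {v = v} {b} = mk⇔
  (λ t → Any.map isBlock-sound (toList⁻ (any⁻ (isBlock b) (toList v) t)))
  (λ b∈ → any⁺ (isBlock b) (toList⁺ (Any.map (λ { refl → fromWitness refl }) b∈)))
  where
  isBlock-sound : ∀ {l} → T (isBlock b l) → inj₂ b ≡ l
  isBlock-sound {inj₂ c} t = cong inj₂ (toWitness t)

valid⇔Valid : {v : Vec (Label m n) k} → T (valid v) ⇔ Valid v
valid⇔Valid {n = n} {v = v} = mk⇔ sound complete
  where
  usedBelow : Fin n → Fin n → Bool
  usedBelow j i = not (toℕ i <ᵇ toℕ j) ∨ used v i
  closedBelow : Fin n → Bool
  closedBelow j = not (used v j) ∨ all (usedBelow j) (allFin n)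
  sound : T (valid v) → Valid v
  sound t {i} {j} i<j j∈ = to used⇔∈ (to (T-not-∨ {toℕ i <ᵇ toℕ j}) usedBelowᵢ (ℕ.<⇒<ᵇ i<j))
    where
    closedⱼ : T (closedBelow j)
    closedⱼ = to (T-all-allFin closedBelow) t j
    usedBelowᵢ : T (usedBelow j i)
    usedBelowᵢ = to (T-all-allFin (usedBelow j)) (to (T-not-∨ {used v j}) closedⱼ (from used⇔∈ j∈)) i
  complete : Valid v → T (valid v)
  complete V = from (T-all-allFin closedBelow) λ j → from (T-not-∨ {used v j}) λ usedⱼ →
               from (T-all-allFin (usedBelow j)) λ i → from (T-not-∨ {toℕ i <ᵇ toℕ j}) λ i<ᵇj →
               from used⇔∈ (V (ℕ.<ᵇ⇒< _ _ i<ᵇj) (to used⇔∈ usedⱼ))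

_∈?_ : (l : Label m n) (v : Vec (Label m n) k) → Dec (l ∈ v)
l ∈? v = Any.any? (≡-dec _≟_ _≟_ l) v

sectionUsed : Fin m → Vec (Label m n) k → Bool
sectionUsed s v = ⌊ inj₁ s ∈? v ⌋

freeUsed : Vec (Label m n) k → Bool
freeUsed v = ⌊ any? (λ b → inj₂ b ∈? v) ⌋

sectionUsed⇔∈ : {s : Fin m} {v : Vec (Label m n) k} → T (sectionUsed s v) ⇔ inj₁ s ∈ v
sectionUsed⇔∈ = mk⇔ toWitness fromWitness

sectionUnused⇔∉ : {s : Fin m} {v : Vec (Label m n) k} → T (not (sectionUsed s v)) ⇔ inj₁ s ∉ v
sectionUnused⇔∉ = mk⇔ toWitnessFalse fromWitnessFalse

freeUsed⇔∃∈ : {v : Vec (Label m n) k} → T (freeUsed v) ⇔ ∃ λ b → inj₂ b ∈ v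
freeUsed⇔∃∈ = mk⇔ toWitness fromWitness

freeUnused⇔∄∈ : {v : Vec (Label m n) k} → T (not (freeUsed v)) ⇔ (¬ ∃ λ b → inj₂ b ∈ v)
freeUnused⇔∄∈ = mk⇔ toWitnessFalse fromWitnessFalse

T-valid-∧ : {v : Vec (Label m n) k} {b : Bool} → T (valid v ∧ b) ⇔ (Valid v × T b)
T-valid-∧ {v = v} {b} = mk⇔ split (λ (V , t) → from T-∧ (from valid⇔Valid V , t))
  where
  split : T (valid v ∧ b) → Valid v × T b
  split t = let (t₁ , t₂) = to T-∧ t in to valid⇔Valid t₁ , t₂

Valid⇒zero∈ : {v : Vec (Label m (suc n)) k} {b : Fin (suc n)} → Valid v → inj₂ b ∈ v → inj₂ zero ∈ v
Valid⇒zero∈ {b = zero}  _ b∈ = b∈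
Valid⇒zero∈ {b = suc _} V b∈ = V z<s b∈

-- If the last block were used, validity would force all suc n blocks to be used; together with
-- the occupied restricted section that makes suc (suc n) distinct labels in a vector of length suc n.
Valid⇒lastBlock∉ : {v : Vec (Label m (suc n)) (suc n)} {s : Fin m} →
                   Valid v → inj₁ s ∈ v → inj₂ (fromℕ n) ∉ v
Valid⇒lastBlock∉ {m} {n} {v} {s} V s∈v last∈v =
  ℕ.1+n≰n (injective-∈⇒≤ label label-injective label∈v)
  where
  label : Fin (suc (suc n)) → Label m (suc n)
  label zero    = inj₁ s
  label (suc b) = inj₂ b
  label-injective : Injective _≡_ _≡_ label
  label-injective {zero}  {zero}  _  = refl
  label-injective {suc _} {suc _} eq = cong suc (inj₂-injective eq)
  label-injective {zero}  {suc _} ()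
  label-injective {suc _} {zero}  ()
  label∈v : ∀ i → label i ∈ v
  label∈v zero = s∈v
  label∈v (suc b) with b ≟ fromℕ n
  ... | yes refl  = last∈v
  ... | no b≢last = V (≤∧≢⇒< (≤fromℕ b) b≢last) last∈v

inj₂∈map-map₁ : {f : Fin m → Fin k} {v : Vec (Label m n) k′} {b : Fin n} →
                inj₂ b ∈ map (Sum.map₁ f) v ⇔ inj₂ b ∈ v
inj₂∈map-map₁ {f = f} = mk⇔ (Any.map inj₂≡map₁ ∘ Anyₚ.map⁻) (∈-map⁺ (Sum.map₁ f))
  where
  inj₂≡map₁ : ∀ {b l} → inj₂ b ≡ Sum.map₁ f l → inj₂ b ≡ l
  inj₂≡map₁ {l = inj₂ _} refl = refl

Valid-map₁ : (f : Fin m → Fin k) {v : Vec (Label m n) k′} → Valid v → Valid (map (Sum.map₁ f) v)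
Valid-map₁ f V i<j j∈ = from inj₂∈map-map₁ (V i<j (to inj₂∈map-map₁ j∈))

toSectionOne : Label m n → Label (suc k) n
toSectionOne = Sum.map₁ (λ _ → zero)

count-sectionTwoUnused : (n : ℕ) →
  count (λ v → valid v ∧ not (sectionUsed (suc zero) v)) (arrangements 2 n) ≡ I 1 n
count-sectionTwoUnused n = count-inverse (map toSectionOne) (map toSectionOne)
  (arrangements-enumerates 2 n) (arrangements-enumerates 1 n) forth back
  where
  S₂ : Label 2 n
  S₂ = inj₁ (suc zero)
  forth : ∀ {v} → T (valid v ∧ not (sectionUsed (suc zero) v)) →
          T (valid (map toSectionOne v)) × map toSectionOne (map toSectionOne v) ≡ v
  forth {v} t with V , S₂∉v ← to T-valid-∧ t =
    from (valid⇔Valid {v = map toSectionOne v}) (Valid-map₁ _ V) ,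
    map∘map-cancel v (λ {l} l∈v → toSectionOne-cancel l (λ { refl → to sectionUnused⇔∉ S₂∉v l∈v }))
    where
    toSectionOne-cancel : ∀ l → l ≢ S₂ → toSectionOne (toSectionOne {k = 0} l) ≡ l
    toSectionOne-cancel (inj₁ zero)       _    = refl
    toSectionOne-cancel (inj₁ (suc zero)) l≢S₂ = contradiction refl l≢S₂
    toSectionOne-cancel (inj₂ _)          _    = refl
  back : ∀ {w} → T (valid w) →
         T (valid (map toSectionOne w) ∧ not (sectionUsed (suc zero) (map toSectionOne w))) ×
         map toSectionOne (map toSectionOne w) ≡ w
  back {w} t =
    from (T-valid-∧ {v = map toSectionOne w}) (Valid-map₁ _ (to valid⇔Valid t) , from sectionUnused⇔∉ S₂∉) ,
    map∘map-cancel w (λ {l} _ → toSectionOne-involutive l)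
    where
    S₂∉ : S₂ ∉ map toSectionOne w
    S₂∉ = ∉-map λ { (inj₁ _) () ; (inj₂ _) () }
    toSectionOne-involutive : ∀ l → toSectionOne (toSectionOne {k = 1} l) ≡ l
    toSectionOne-involutive (inj₁ zero) = refl
    toSectionOne-involutive (inj₂ _)    = refl
    toSectionOne-involutive (inj₁ (suc ()))

I₁⁺ : ℕ → ℕ
I₁⁺ n = count (λ w → valid w ∧ freeUsed w) (arrangements 1 n)

module _ {k : ℕ} where

  sucBlock : Fin (suc k) → Fin (suc k)
  sucBlock b with view b
  ... | ‵fromℕ     = fromℕ k  -- junk: the last block is unused wherever removeBar is applied
  ... | ‵inject₁ c = suc c

  removeBar : Label 2 (suc k) → Label 1 (suc k)
  removeBar (inj₁ zero)       = inj₁ zero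
  removeBar (inj₁ (suc zero)) = inj₂ zero
  removeBar (inj₂ b)          = inj₂ (sucBlock b)

  insertBar : Label 1 (suc k) → Label 2 (suc k)
  insertBar (inj₁ zero)    = inj₁ zero
  insertBar (inj₂ zero)    = inj₁ (suc zero)
  insertBar (inj₂ (suc c)) = inj₂ (inject₁ c)

  removeBar∘insertBar : ∀ l → removeBar (insertBar l) ≡ l
  removeBar∘insertBar (inj₁ zero)    = refl
  removeBar∘insertBar (inj₂ zero)    = refl
  removeBar∘insertBar (inj₂ (suc c)) rewrite view-inject₁ c = refl

  insertBar∘removeBar : ∀ l → l ≢ inj₂ (fromℕ k) → insertBar (removeBar l) ≡ l
  insertBar∘removeBar (inj₁ zero)       _ = refl
  insertBar∘removeBar (inj₁ (suc zero)) _ = refl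
  insertBar∘removeBar (inj₂ b) l≢last with view b
  ... | ‵fromℕ     = contradiction refl l≢last
  ... | ‵inject₁ c = refl

  insertBar-injective : Injective _≡_ _≡_ insertBar
  insertBar-injective {l} {l′} eq = begin
    l                        ≡⟨ removeBar∘insertBar l ⟨
    removeBar (insertBar l)  ≡⟨ cong removeBar eq ⟩
    removeBar (insertBar l′) ≡⟨ removeBar∘insertBar l′ ⟩
    l′                       ∎

  ∈-map-insertBar : {w : Vec (Label 1 (suc k)) k′} → ∀ l → insertBar l ∈ map insertBar w ⇔ l ∈ w
  ∈-map-insertBar = ∈-map-injective insertBar-injective

  lastBlock∉map-insertBar : {w : Vec (Label 1 (suc k)) k′} → inj₂ (fromℕ k) ∉ map insertBar w
  lastBlock∉map-insertBar = ∉-map last≢insertBar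
    where
    last≢insertBar : ∀ l → inj₂ (fromℕ k) ≢ insertBar l
    last≢insertBar (inj₁ zero)    ()
    last≢insertBar (inj₂ zero)    ()
    last≢insertBar (inj₂ (suc c)) eq = fromℕ≢inject₁ (inj₂-injective eq)
    last≢insertBar (inj₁ (suc ()))

  inject₁-<-⇔ : {a c : Fin k} → inject₁ a < inject₁ c ⇔ a < c
  inject₁-<-⇔ {a} {c} = mk⇔ (subst₂ _<ℕ_ (toℕ-inject₁ a) (toℕ-inject₁ c))
                             (subst₂ _<ℕ_ (sym (toℕ-inject₁ a)) (sym (toℕ-inject₁ c)))

  Valid-insertBar : {w : Vec (Label 1 (suc k)) k′} {b : Fin (suc k)} → Valid w → inj₂ b ∈ w →
                    Valid (map insertBar w) × inj₁ (suc zero) ∈ map insertBar w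
  Valid-insertBar {w = w} V b∈w = valid′ , from (∈-map-insertBar (inj₂ zero)) (Valid⇒zero∈ V b∈w)
    where
    valid′ : Valid (map insertBar w)
    valid′ {i} {j} i<j j∈ with view j | view i
    ... | ‵fromℕ     | _          = contradiction j∈ lastBlock∉map-insertBar
    ... | ‵inject₁ c | ‵fromℕ     = contradiction (≤fromℕ (inject₁ c)) (ℕ.<⇒≱ i<j)
    ... | ‵inject₁ c | ‵inject₁ a =
      from (∈-map-insertBar (inj₂ (suc a))) (V (s<s (to inject₁-<-⇔ i<j)) (to (∈-map-insertBar (inj₂ (suc c))) j∈))

  Valid-insertBar⁻ : {w : Vec (Label 1 (suc k)) k′} →
                     Valid (map insertBar w) → inj₁ (suc zero) ∈ map insertBar w →
                     Valid w × inj₂ zero ∈ w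
  Valid-insertBar⁻ {w = w} V S₂∈ = valid′ , zero∈
    where
    zero∈ : inj₂ zero ∈ w
    zero∈ = to (∈-map-insertBar (inj₂ zero)) S₂∈
    valid′ : Valid w
    valid′ {zero}  {suc _} _          _  = zero∈
    valid′ {suc a} {suc c} (s<s a<c) j∈ =
      to (∈-map-insertBar (inj₂ (suc a))) (V (from inject₁-<-⇔ a<c) (from (∈-map-insertBar (inj₂ (suc c))) j∈))

  insertBar∘removeBar-cancel : {v : Vec (Label 2 (suc k)) (suc k)} → Valid v → inj₁ (suc zero) ∈ v →
                               map insertBar (map removeBar v) ≡ v
  insertBar∘removeBar-cancel {v} V S₂∈v =
    map∘map-cancel v (λ {l} l∈v → insertBar∘removeBar l (λ { refl → Valid⇒lastBlock∉ V S₂∈v l∈v }))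

  Valid-removeBar : {v : Vec (Label 2 (suc k)) (suc k)} → Valid v → inj₁ (suc zero) ∈ v →
                    Valid (map removeBar v) × inj₂ zero ∈ map removeBar v
  Valid-removeBar {v} V S₂∈v = Valid-insertBar⁻ (subst Valid v≡ V) (subst (inj₁ (suc zero) ∈_) v≡ S₂∈v)
    where
    v≡ : v ≡ map insertBar (map removeBar v)
    v≡ = sym (insertBar∘removeBar-cancel V S₂∈v)

count-sectionTwoUsed : (n : ℕ) →
  count (λ v → valid v ∧ sectionUsed (suc zero) v) (arrangements 2 n) ≡ I₁⁺ n
count-sectionTwoUsed 0       = refl
count-sectionTwoUsed (suc k) = count-inverse (map removeBar) (map insertBar)
  (arrangements-enumerates 2 (suc k)) (arrangements-enumerates 1 (suc k)) forth back
  where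
  forth : ∀ {v} → T (valid v ∧ sectionUsed (suc zero) v) →
          T (valid (map removeBar v) ∧ freeUsed (map removeBar v)) × map insertBar (map removeBar v) ≡ v
  forth {v} t =
    let (V , S₂∈v) = to T-valid-∧ t
        (W , zero∈w) = Valid-removeBar V (to sectionUsed⇔∈ S₂∈v)
    in from (T-valid-∧ {v = map removeBar v}) (W , from freeUsed⇔∃∈ (zero , zero∈w)) ,
       insertBar∘removeBar-cancel V (to sectionUsed⇔∈ S₂∈v)
  back : ∀ {w} → T (valid w ∧ freeUsed w) →
         T (valid (map insertBar w) ∧ sectionUsed (suc zero) (map insertBar w)) × map removeBar (map insertBar w) ≡ w
  back {w} t =
    let (W , free) = to T-valid-∧ t
        (b , b∈w) = to freeUsed⇔∃∈ free
        (V , S₂∈) = Valid-insertBar W b∈w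
    in from (T-valid-∧ {v = map insertBar w}) (V , from sectionUsed⇔∈ S₂∈) ,
       map∘map-cancel w (λ {l} _ → removeBar∘insertBar l)

free∉⇒replicate : {w : Vec (Label 1 n) k} → (¬ ∃ λ b → inj₂ b ∈ w) → w ≡ replicate k (inj₁ zero)
free∉⇒replicate {w = []}             _     = refl
free∉⇒replicate {w = inj₁ zero ∷ w} free∉ = cong (inj₁ zero ∷_) (free∉⇒replicate (λ (b , b∈) → free∉ (b , there b∈)))
free∉⇒replicate {w = inj₂ b ∷ w}    free∉ = contradiction (b , here refl) free∉

free∉replicate : {s : Fin m} → ¬ ∃ λ (b : Fin n) → inj₂ b ∈ replicate k (inj₁ s)
free∉replicate {k = suc k} (b , there b∈) = free∉replicate (b , b∈)

count-freeUnused : (n : ℕ) → count (λ w → valid w ∧ not (freeUsed w)) (arrangements 1 n) ≡ 1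
count-freeUnused n = count-≡1 allInS₁ (arrangements-enumerates 1 n) (mk⇔ sound complete)
  where
  allInS₁ : Vec (Label 1 n) n
  allInS₁ = replicate n (inj₁ zero)
  sound : ∀ {w} → T (valid w ∧ not (freeUsed w)) → w ≡ allInS₁
  sound t = free∉⇒replicate (to freeUnused⇔∄∈ (proj₂ (to T-∧ t)))
  complete : ∀ {w} → w ≡ allInS₁ → T (valid w ∧ not (freeUsed w))
  complete refl = from (T-valid-∧ {v = allInS₁})
    ((λ _ j∈ → contradiction (_ , j∈) free∉replicate) , from freeUnused⇔∄∈ free∉replicate)

I₁≡1+I₁⁺ : (n : ℕ) → I 1 n ≡ suc (I₁⁺ n)
I₁≡1+I₁⁺ n = trans (count-split valid freeUsed (arrangements 1 n)) (cong (_+ I₁⁺ n) (count-freeUnused n))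

I₂≡I₁+I₁⁺ : (n : ℕ) → I 2 n ≡ I 1 n + I₁⁺ n
I₂≡I₁+I₁⁺ n = trans (count-split valid (sectionUsed (suc zero)) (arrangements 2 n))
                    (cong₂ _+_ (count-sectionTwoUnused n) (count-sectionTwoUsed n))

2[1+d]-1≡1+d+d : (d : ℕ) → + 2 * + suc d - + 1 ≡ + (suc d + d)
2[1+d]-1≡1+d+d d = cong +_ (trans (cong (λ e → d + e) (ℕ.*-identityˡ (suc d))) (ℕ.+-suc d d))

lemma3 : (n : ℕ) → (+ 2) * (+ I 1 n) - (+ 1) ≡ + I 2 n
lemma3 n = begin
  + 2 * + I 1 n - + 1        ≡⟨ cong (λ i → + 2 * + i - + 1) (I₁≡1+I₁⁺ n) ⟩
  + 2 * + suc (I₁⁺ n) - + 1  ≡⟨ 2[1+d]-1≡1+d+d (I₁⁺ n) ⟩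
  + (suc (I₁⁺ n) + I₁⁺ n)    ≡⟨ cong (λ i → + (i + I₁⁺ n)) (I₁≡1+I₁⁺ n) ⟨
  + (I 1 n + I₁⁺ n)          ≡⟨ cong +_ (I₂≡I₁+I₁⁺ n) ⟨
  + I 2 n                    ∎
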